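{- Let $f$ be an $s$-term exact-$k$ DNF over $\{0,1\}^n$ with a fixed representation, whose terms are called true terms, and let $\mathcal{L}$ be a list of terms. Fix a term $T\in\mathcal{L}$ such that $\mathrm{d}_{\mathrm{term}}(T,T') > 2\log(s)$ for all true terms $T'$ of $f$. Then \[ \Pr\big[T\in \textsc{Prune}(f,\mathcal{L})\big] \le \frac{1}{10^n}, \] where the probability is over the randomness of $\textsc{Prune}$.
   Context: A term is a conjunction of literals, identified with its set of literals; $|T|$ is its number of literals. An exact-$k$ DNF is a DNF in which every term has exactly $k$ distinct literals. For terms $T_1,T_2$, $\mathrm{d}_{\mathrm{term}}(T_1,T_2)=\min\{|T_1\setminus T_2|,|T_2\setminus T_1|\}$. Procedure $\textsc{Prune}(f,\mathcal{L})$ (with membership-query access to $f$): start with $\mathcal{L}'=\mathcal{L}$; for each $T\in\mathcal{L}$: if $|T|\ne k$ remove $T$ from $\mathcal{L}'$; otherwise repeat $100n$ times: draw $\mathbf{z}$ uniformly from the satisfying assignments of $T$, and if $f(\mathbf{z})=0$ remove $T$ from $\mathcal{L}'$ and move to the next term. Return $\mathcal{L}'$. Logarithms are base 2. -}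

module Defs where

open import Data.Nat using (ℕ; zero; suc; _+_; _*_; _^_; _≤_; _<_)
open import Data.Bool using (Bool; true; false; _∧_; _∨_; not; if_then_else_)
open import Data.Bool.Properties using () renaming (_≟_ to _≟B_)
open import Data.Maybe using (Maybe; just; nothing)
open import Data.Vec using (Vec; []; _∷_; toList)
open import Data.List using (List; []; _∷_; length; map; concatMap; filter; zip)
open import Data.Bool.ListAction using (all; any)
open import Data.Product using (_×_; _,_)
open import Relation.Nullary using (does)
open import Relation.Binary.PropositionalEquality using (_≡_)
import Data.Vec.Properties as VP
import Data.Maybe.Properties as MP

Assign : ℕ → Set
Assign n = Vec Bool n

-- A term over n variables, identified with its set of literals:
-- position i is  nothing  (variable x_i does not occur),
-- just true (literal x_i) or just false (literal ¬x_i).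
Term : ℕ → Set
Term n = Vec (Maybe Bool) n

_≟T_ : ∀ {n} (T₁ T₂ : Term n) → Relation.Nullary.Dec (T₁ ≡ T₂)
_≟T_ = VP.≡-dec (MP.≡-dec _≟B_)

size : ∀ {n} → Term n → ℕ
size []             = 0
size (nothing ∷ T)  = size T
size (just _  ∷ T)  = suc (size T)

setDiff : ∀ {n} → Term n → Term n → ℕ
setDiff []             []            = 0
setDiff (nothing ∷ T)  (_ ∷ U)       = setDiff T U
setDiff (just b ∷ T)   (nothing ∷ U) = suc (setDiff T U)
setDiff (just b ∷ T)   (just c ∷ U)  =
  if does (b ≟B c) then setDiff T U else suc (setDiff T U)

dterm : ∀ {n} → Term n → Term n → ℕ
dterm T₁ T₂ = Data.Nat._⊓_ (setDiff T₁ T₂) (setDiff T₂ T₁)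

sat : ∀ {n} → Term n → Assign n → Bool
sat []            []      = true
sat (nothing ∷ T) (_ ∷ z) = sat T z
sat (just b ∷ T)  (x ∷ z) = does (b ≟B x) ∧ sat T z

-- A DNF with s terms (the fixed representation; its terms are the true terms).
DNF : ℕ → ℕ → Set
DNF n s = Vec (Term n) s

data ExactK {n} (k : ℕ) : ∀ {s} → DNF n s → Set where
  []  : ExactK k []
  _∷_ : ∀ {s T} {f : DNF n s} → size T ≡ k → ExactK k f → ExactK k (T ∷ f)

data _∈T_ {n} (T : Term n) : ∀ {s} → DNF n s → Set where
  here  : ∀ {s} {f : DNF n s} → T ∈T (T ∷ f)
  there : ∀ {s U} {f : DNF n s} → T ∈T f → T ∈T (U ∷ f)

eval : ∀ {n s} → DNF n s → Assign n → Bool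
eval f z = any (λ T → sat T z) (toList f)

allAssign : (n : ℕ) → List (Assign n)
allAssign zero    = [] ∷ []
allAssign (suc n) = concatMap (λ z → (false ∷ z) ∷ (true ∷ z) ∷ []) (allAssign n)

-- the satisfying assignments of T (the uniform sample space for one draw)
satAssign : ∀ {n} → Term n → List (Assign n)
satAssign {n} T = filter (λ z → Data.Bool._≟_ (sat T z) true) (allAssign n)

allSeqs : ∀ {A : Set} (m : ℕ) → List A → List (Vec A m)
allSeqs zero    xs = [] ∷ []
allSeqs (suc m) xs = concatMap (λ x → map (x ∷_) (allSeqs m xs)) xs

-- number of draws made for each term
reps : ℕ → ℕ
reps n = 100 * n

-- Random seed of Prune(f,L): for each entry T of L (in order) a sequence of
-- 100n independent uniform samples from the satisfying assignments of T.
-- The sample space (every outcome equally likely):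
seeds : ∀ {n} → List (Term n) → List (List (Vec (Assign n) (reps n)))
seeds []      = [] ∷ []
seeds {n} (T ∷ L) =
  concatMap (λ d → map (d ∷_) (seeds L)) (allSeqs (reps n) (satAssign T))

removed : ∀ {n s} → ℕ → DNF n s → Term n → Vec (Assign n) (reps n) → Bool
removed k f T d =
  not (does (Data.Nat._≟_ (size T) k)) ∨ not (all (eval f) (toList d))

memB : ∀ {n} → Term n → List (Term n) → Bool
memB T L = any (λ U → does (T ≟T U)) L

prune : ∀ {n s} → ℕ → DNF n s → List (Term n)
      → List (Vec (Assign n) (reps n)) → List (Term n)
prune {n} k f L ω =
  filter (λ T → Data.Bool._≟_ (memB T removedTerms) false) L
  where
  removedTerms : List (Term n)
  removedTerms = Data.List.mapMaybe
    (λ p → let (T , d) = p in if removed k f T d then just T else nothing)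
    (zip L ω)

countB : ∀ {A : Set} → (A → Bool) → List A → ℕ
countB p []       = 0
countB p (x ∷ xs) = if p x then suc (countB p xs) else countB p xs

-- Pr[T ∈ Prune(f,L)] = probNum / probDen
probNum : ∀ {n s} → ℕ → DNF n s → List (Term n) → Term n → ℕ
probNum k f L T = countB (λ ω → memB T (prune k f L ω)) (seeds L)

probDen : ∀ {n} → List (Term n) → ℕ
probDen L = length (seeds L)

{-# OPTIONS --safe #-}
-- Fix an occurrence of T in L.  T survives Prune only if every one of the 100n
-- draws made for it satisfies f.  For a true term U, the literals of U outside T
-- are independent fair bits under a uniform satisfying assignment of T, so it also
-- satisfies U with probability at most 2^-|U \ T| ≤ 2^-dterm(T,U) < 1/s².  A union
-- bound over the s true terms gives Pr[f(z) = 1] ≤ s/(s² + 1) ≤ 1/2, hence survival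
-- has probability at most 2^-100n ≤ 10^-n.  All probabilities are ratios of counts
-- over the explicit sample spaces.
module Submission where

open import Defs
open import Data.Nat using (ℕ; zero; suc; _+_; _*_; _^_; _≤_; _<_; z≤n; s≤s; _≤?_)
open import Data.Nat.Properties
open import Data.Nat.Tactic.RingSolver using (solve-∀)
open import Data.Bool using (Bool; true; false; _∧_; _∨_; not; if_then_else_)
open import Data.Bool.Properties
  using (∧-comm; ∧-zeroʳ; ∧-identityʳ; ∧-distribˡ-∨; ∧-commutativeMonoid)
  renaming (_≟_ to _≟B_)
open import Data.Bool.ListAction using (all)
open import Data.Maybe using (Maybe; just; nothing)
open import Data.Vec using (Vec; []; _∷_; toList)
open import Data.List using (List; []; _∷_; _++_; map; concatMap; length; filter; zip; mapMaybe)
open import Data.List.Membership.Propositional using (_∈_)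
open import Data.List.Relation.Unary.Any using (here; there)
open import Data.Product using (proj₁; proj₂)
open import Data.Empty using (⊥-elim)
open import Relation.Binary.PropositionalEquality
open import Relation.Nullary using (does; yes; no)
open import Relation.Nullary.Decidable using (toWitness)
open import Algebra.Bundles using (CommutativeMonoid)
open import Algebra.Properties.CommutativeSemigroup
  (CommutativeMonoid.commutativeSemigroup ∧-commutativeMonoid) using (interchange)

module _ {A : Set} where

  countB-++ : (p : A → Bool) (xs ys : List A) → countB p (xs ++ ys) ≡ countB p xs + countB p ys
  countB-++ p []       ys = refl
  countB-++ p (x ∷ xs) ys with p x
  ... | true  = cong suc (countB-++ p xs ys)
  ... | false = countB-++ p xs ys

  countB-cong : {p q : A → Bool} → (∀ x → p x ≡ q x) → (xs : List A) → countB p xs ≡ countB q xs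
  countB-cong p≗q []       = refl
  countB-cong p≗q (x ∷ xs) rewrite p≗q x = cong (λ m → if _ then suc m else m) (countB-cong p≗q xs)

  countB-zero : {p : A → Bool} → (∀ x → p x ≡ false) → (xs : List A) → countB p xs ≡ 0
  countB-zero p≗false []       = refl
  countB-zero p≗false (x ∷ xs) rewrite p≗false x = countB-zero p≗false xs

  countB-mono : {p q : A → Bool} → (∀ x → p x ≡ true → q x ≡ true) → (xs : List A)
              → countB p xs ≤ countB q xs
  countB-mono p⇒q [] = z≤n
  countB-mono {p} {q} p⇒q (x ∷ xs) with p x in px | q x in qx
  ... | true  | true  = s≤s (countB-mono p⇒q xs)
  ... | true  | false with () ← trans (sym (p⇒q x px)) qx
  ... | false | true  = m≤n⇒m≤1+n (countB-mono p⇒q xs)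
  ... | false | false = countB-mono p⇒q xs

  countB-∨ : (p q : A → Bool) (xs : List A)
           → countB (λ x → p x ∨ q x) xs ≤ countB p xs + countB q xs
  countB-∨ p q [] = z≤n
  countB-∨ p q (x ∷ xs) with p x | q x
  ... | true  | true  = s≤s (≤-trans (countB-∨ p q xs) (+-monoʳ-≤ (countB p xs) (n≤1+n _)))
  ... | true  | false = s≤s (countB-∨ p q xs)
  ... | false | true  = ≤-trans (s≤s (countB-∨ p q xs)) (≤-reflexive (sym (+-suc _ _)))
  ... | false | false = countB-∨ p q xs

  length≡countB-true : (xs : List A) → length xs ≡ countB (λ _ → true) xs
  length≡countB-true []       = refl
  length≡countB-true (x ∷ xs) = cong suc (length≡countB-true xs)

  countB-filter : (b p : A → Bool) (xs : List A)
                → countB p (filter (λ x → Data.Bool._≟_ (b x) true) xs) ≡ countB (λ x → b x ∧ p x) xs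
  countB-filter b p [] = refl
  countB-filter b p (x ∷ xs) with b x
  ... | false = countB-filter b p xs
  ... | true with p x
  ...   | true  = cong suc (countB-filter b p xs)
  ...   | false = countB-filter b p xs

countB-map : {A B : Set} {p : B → Bool} {q : A → Bool} (h : A → B) → (∀ x → p (h x) ≡ q x)
           → (xs : List A) → countB p (map h xs) ≡ countB q xs
countB-map h ph≗q []       = refl
countB-map h ph≗q (x ∷ xs) rewrite ph≗q x = cong (λ m → if _ then suc m else m) (countB-map h ph≗q xs)

countB-concatMap-map : {A B C : Set} {p : C → Bool} {q : A → Bool} {r : B → Bool} (h : A → B → C)
                     → (∀ a b → p (h a b) ≡ q a ∧ r b) → (as : List A) (bs : List B)
                     → countB p (concatMap (λ a → map (h a) bs) as) ≡ countB q as * countB r bs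
countB-concatMap-map h p≗q∧r [] bs = refl
countB-concatMap-map {p = p} {q} {r} h p≗q∧r (a ∷ as) bs = begin
  countB p (map (h a) bs ++ concatMap (λ a → map (h a) bs) as)
    ≡⟨ countB-++ p (map (h a) bs) _ ⟩
  countB p (map (h a) bs) + countB p (concatMap (λ a → map (h a) bs) as)
    ≡⟨ cong₂ _+_ (countB-map (h a) (p≗q∧r a) bs) (countB-concatMap-map h p≗q∧r as bs) ⟩
  countB (λ b → q a ∧ r b) bs + countB q as * countB r bs
    ≡⟨ head-row (q a) ⟩
  countB q (a ∷ as) * countB r bs ∎
  where
  open ≡-Reasoning
  head-row : ∀ qa → countB (λ b → qa ∧ r b) bs + countB q as * countB r bs
                  ≡ (if qa then suc (countB q as) else countB q as) * countB r bs
  head-row true  = refl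
  head-row false = cong (_+ countB q as * countB r bs) (countB-zero (λ _ → refl) bs)

length-concatMap-map : {A B C : Set} (h : A → B → C) (as : List A) (bs : List B)
                     → length (concatMap (λ a → map (h a) bs) as) ≡ length as * length bs
length-concatMap-map h as bs = begin
  length (concatMap (λ a → map (h a) bs) as)
    ≡⟨ length≡countB-true (concatMap (λ a → map (h a) bs) as) ⟩
  countB (λ _ → true) (concatMap (λ a → map (h a) bs) as)
    ≡⟨ countB-concatMap-map h (λ _ _ → refl) as bs ⟩
  countB (λ _ → true) as * countB (λ _ → true) bs
    ≡⟨ sym (cong₂ _*_ (length≡countB-true as) (length≡countB-true bs)) ⟩
  length as * length bs ∎
  where open ≡-Reasoning

^-distribʳ-* : ∀ a b m → (a * b) ^ m ≡ a ^ m * b ^ m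
^-distribʳ-* a b zero    = refl
^-distribʳ-* a b (suc m) = begin
  a * b * (a * b) ^ m     ≡⟨ cong (a * b *_) (^-distribʳ-* a b m) ⟩
  a * b * (a ^ m * b ^ m) ≡⟨ rearrange a b (a ^ m) (b ^ m) ⟩
  a * a ^ m * (b * b ^ m) ∎
  where
  open ≡-Reasoning
  rearrange : ∀ a b x y → a * b * (x * y) ≡ a * x * (b * y)
  rearrange = solve-∀

2*n≤1+n*n : ∀ n → 2 * n ≤ suc (n * n)
2*n≤1+n*n zero    = z≤n
2*n≤1+n*n (suc t) = ≤-trans (m≤m+n (2 * suc t) (t * t)) (≤-reflexive (square t))
  where
  square : ∀ t → 2 * suc t + t * t ≡ suc (suc t * suc t)
  square = solve-∀

m*[1+n*n]≤n*o⇒2*m≤o : ∀ n m o → m * suc (n * n) ≤ n * o → 2 * m ≤ o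
m*[1+n*n]≤n*o⇒2*m≤o zero m o m*1≤0 with n≤0⇒n≡0 (≤-trans (≤-reflexive (sym (*-identityʳ m))) m*1≤0)
... | refl = z≤n
m*[1+n*n]≤n*o⇒2*m≤o n@(suc _) m o bound = *-cancelˡ-≤ n (begin
  n * (2 * m)     ≡⟨ rearrange n m ⟩
  m * (2 * n)     ≤⟨ *-monoʳ-≤ m (2*n≤1+n*n n) ⟩
  m * suc (n * n) ≤⟨ bound ⟩
  n * o           ∎)
  where
  open ≤-Reasoning
  rearrange : ∀ n m → n * (2 * m) ≡ m * (2 * n)
  rearrange = solve-∀

#_ : ∀ {n} → (Assign n → Bool) → ℕ
#_ {n} p = countB p (allAssign n)

bits : List Bool
bits = false ∷ true ∷ []

#-∷ : ∀ {n} {p : Assign (suc n) → Bool} (P : Assign n → Bool) (q : Bool → Bool)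
    → (∀ x z → p (x ∷ z) ≡ P z ∧ q x) → # p ≡ # P * countB q bits
#-∷ {n} P q p≗P∧q = countB-concatMap-map (λ z x → x ∷ z) (λ z x → p≗P∧q x z) (allAssign n) bits

litSat : Maybe Bool → Bool → Bool
litSat nothing  x = true
litSat (just b) x = does (b ≟B x)

litDiff : Maybe Bool → Maybe Bool → ℕ
litDiff nothing      b            = 0
litDiff (just a)     nothing      = 1
litDiff (just false) (just false) = 0
litDiff (just false) (just true)  = 1
litDiff (just true)  (just false) = 1
litDiff (just true)  (just true)  = 0

sat-∷ : ∀ {n} a (T : Term n) x z → sat (a ∷ T) (x ∷ z) ≡ sat T z ∧ litSat a x
sat-∷ nothing  T x z = sym (∧-identityʳ (sat T z))
sat-∷ (just b) T x z = ∧-comm (does (b ≟B x)) (sat T z)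

setDiff-∷ : ∀ {n} a b (T U : Term n) → setDiff (a ∷ T) (b ∷ U) ≡ litDiff a b + setDiff T U
setDiff-∷ nothing      b            T U = refl
setDiff-∷ (just a)     nothing      T U = refl
setDiff-∷ (just false) (just false) T U = refl
setDiff-∷ (just false) (just true)  T U = refl
setDiff-∷ (just true)  (just false) T U = refl
setDiff-∷ (just true)  (just true)  T U = refl

#sat-∷ : ∀ {n} a (T : Term n) → # sat (a ∷ T) ≡ # sat T * countB (litSat a) bits
#sat-∷ a T = #-∷ (sat T) (litSat a) (sat-∷ a T)

#sat-∧-sat-∷ : ∀ {n} a b (T U : Term n)
             → # (λ z → sat (a ∷ T) z ∧ sat (b ∷ U) z)
             ≡ # (λ z → sat T z ∧ sat U z) * countB (λ x → litSat a x ∧ litSat b x) bits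
#sat-∧-sat-∷ a b T U = #-∷ (λ z → sat T z ∧ sat U z) (λ x → litSat a x ∧ litSat b x) split
  where
  split : ∀ x z → sat (a ∷ T) (x ∷ z) ∧ sat (b ∷ U) (x ∷ z)
                ≡ (sat T z ∧ sat U z) ∧ (litSat a x ∧ litSat b x)
  split x z = trans (cong₂ _∧_ (sat-∷ a T x z) (sat-∷ b U x z))
                    (interchange (sat T z) (litSat a x) (sat U z) (litSat b x))

litSat-∧-litSat*2^litDiff≤litSat : ∀ a b
  → countB (λ x → litSat a x ∧ litSat b x) bits * 2 ^ litDiff b a ≤ countB (litSat a) bits
litSat-∧-litSat*2^litDiff≤litSat nothing      nothing      = ≤-refl
litSat-∧-litSat*2^litDiff≤litSat nothing      (just false) = ≤-refl
litSat-∧-litSat*2^litDiff≤litSat nothing      (just true)  = ≤-refl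
litSat-∧-litSat*2^litDiff≤litSat (just false) nothing      = ≤-refl
litSat-∧-litSat*2^litDiff≤litSat (just true)  nothing      = ≤-refl
litSat-∧-litSat*2^litDiff≤litSat (just false) (just false) = ≤-refl
litSat-∧-litSat*2^litDiff≤litSat (just false) (just true)  = z≤n
litSat-∧-litSat*2^litDiff≤litSat (just true)  (just false) = z≤n
litSat-∧-litSat*2^litDiff≤litSat (just true)  (just true)  = ≤-refl

#sat-∧-sat*2^setDiff≤#sat : ∀ {n} (T U : Term n)
  → # (λ z → sat T z ∧ sat U z) * 2 ^ setDiff U T ≤ # sat T
#sat-∧-sat*2^setDiff≤#sat []      []      = ≤-refl
#sat-∧-sat*2^setDiff≤#sat (a ∷ T) (b ∷ U) = begin
  # (λ z → sat (a ∷ T) z ∧ sat (b ∷ U) z) * 2 ^ setDiff (b ∷ U) (a ∷ T)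
    ≡⟨ cong₂ _*_ (#sat-∧-sat-∷ a b T U) (cong (2 ^_) (setDiff-∷ b a U T)) ⟩
  # (λ z → sat T z ∧ sat U z) * w * 2 ^ (litDiff b a + setDiff U T)
    ≡⟨ cong (# (λ z → sat T z ∧ sat U z) * w *_) (^-distribˡ-+-* 2 (litDiff b a) (setDiff U T)) ⟩
  # (λ z → sat T z ∧ sat U z) * w * (2 ^ litDiff b a * 2 ^ setDiff U T)
    ≡⟨ rearrange (# (λ z → sat T z ∧ sat U z)) w (2 ^ litDiff b a) (2 ^ setDiff U T) ⟩
  # (λ z → sat T z ∧ sat U z) * 2 ^ setDiff U T * (w * 2 ^ litDiff b a)
    ≤⟨ *-mono-≤ (#sat-∧-sat*2^setDiff≤#sat T U) (litSat-∧-litSat*2^litDiff≤litSat a b) ⟩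
  # sat T * countB (litSat a) bits
    ≡⟨ sym (#sat-∷ a T) ⟩
  # sat (a ∷ T) ∎
  where
  open ≤-Reasoning
  w = countB (λ x → litSat a x ∧ litSat b x) bits
  rearrange : ∀ c w x y → c * w * (x * y) ≡ c * y * (w * x)
  rearrange = solve-∀

#sat-∧-eval*M≤s*N : ∀ {n s} (T : Term n) (f : DNF n s) (M N : ℕ)
  → (∀ U → U ∈T f → # (λ z → sat T z ∧ sat U z) * M ≤ N)
  → # (λ z → sat T z ∧ eval f z) * M ≤ s * N
#sat-∧-eval*M≤s*N T [] M N _
  rewrite countB-zero (λ z → ∧-zeroʳ (sat T z)) (allAssign _) = z≤n
#sat-∧-eval*M≤s*N {s = suc s} T (U ∷ f) M N bound = begin
  # (λ z → sat T z ∧ (sat U z ∨ eval f z)) * M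
    ≡⟨ cong (_* M) (countB-cong (λ z → ∧-distribˡ-∨ (sat T z) (sat U z) (eval f z)) (allAssign _)) ⟩
  # (λ z → sat T z ∧ sat U z ∨ sat T z ∧ eval f z) * M
    ≤⟨ *-monoˡ-≤ M (countB-∨ (λ z → sat T z ∧ sat U z) (λ z → sat T z ∧ eval f z) (allAssign _)) ⟩
  (# (λ z → sat T z ∧ sat U z) + # (λ z → sat T z ∧ eval f z)) * M
    ≡⟨ *-distribʳ-+ M (# (λ z → sat T z ∧ sat U z)) _ ⟩
  # (λ z → sat T z ∧ sat U z) * M + # (λ z → sat T z ∧ eval f z) * M
    ≤⟨ +-mono-≤ (bound U here) (#sat-∧-eval*M≤s*N T f M N (λ U′ U′∈f → bound U′ (there U′∈f))) ⟩
  N + s * N ∎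
  where open ≤-Reasoning

2*#sat-∧-eval≤#sat : ∀ {n s} (f : DNF n s) (T : Term n)
  → (∀ U → U ∈T f → s * s < 2 ^ dterm T U)
  → 2 * # (λ z → sat T z ∧ eval f z) ≤ # sat T
2*#sat-∧-eval≤#sat {s = s} f T far =
  m*[1+n*n]≤n*o⇒2*m≤o s (# (λ z → sat T z ∧ eval f z)) (# sat T)
    (#sat-∧-eval*M≤s*N T f (suc (s * s)) (# sat T) shared)
  where
  shared : ∀ U → U ∈T f → # (λ z → sat T z ∧ sat U z) * suc (s * s) ≤ # sat T
  shared U U∈f = ≤-trans
    (*-monoʳ-≤ (# (λ z → sat T z ∧ sat U z))
      (≤-trans (far U U∈f) (^-monoʳ-≤ 2 (m⊓n≤n (setDiff T U) (setDiff U T)))))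
    (#sat-∧-sat*2^setDiff≤#sat T U)

2*countB-eval≤length-satAssign : ∀ {n s} (f : DNF n s) (T : Term n)
  → (∀ U → U ∈T f → s * s < 2 ^ dterm T U)
  → 2 * countB (eval f) (satAssign T) ≤ length (satAssign T)
2*countB-eval≤length-satAssign {n} f T far = begin
  2 * countB (eval f) (satAssign T)   ≡⟨ cong (2 *_) (countB-filter (sat T) (eval f) (allAssign n)) ⟩
  2 * # (λ z → sat T z ∧ eval f z)    ≤⟨ 2*#sat-∧-eval≤#sat f T far ⟩
  # sat T                             ≡⟨ sym (countB-cong (λ z → ∧-identityʳ (sat T z)) (allAssign n)) ⟩
  # (λ z → sat T z ∧ true)            ≡⟨ sym (countB-filter (sat T) (λ _ → true) (allAssign n)) ⟩
  countB (λ _ → true) (satAssign T)   ≡⟨ sym (length≡countB-true (satAssign T)) ⟩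
  length (satAssign T)                ∎
  where open ≤-Reasoning

module _ {A : Set} where

  countB-all-allSeqs : (P : A → Bool) (m : ℕ) (xs : List A)
    → countB (λ v → all P (toList v)) (allSeqs m xs) ≡ countB P xs ^ m
  countB-all-allSeqs P zero    xs = refl
  countB-all-allSeqs P (suc m) xs =
    trans (countB-concatMap-map _∷_ (λ _ _ → refl) xs (allSeqs m xs))
          (cong (countB P xs *_) (countB-all-allSeqs P m xs))

  length-allSeqs : (m : ℕ) (xs : List A) → length (allSeqs m xs) ≡ length xs ^ m
  length-allSeqs zero    xs = refl
  length-allSeqs (suc m) xs =
    trans (length-concatMap-map _∷_ xs (allSeqs m xs)) (cong (length xs *_) (length-allSeqs m xs))

draws : ∀ {n} → Term n → List (Vec (Assign n) (reps n))
draws {n} T = allSeqs (reps n) (satAssign T)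

allSatisfy : ∀ {n s} → DNF n s → Vec (Assign n) (reps n) → Bool
allSatisfy f d = all (eval f) (toList d)

10^n≤2^reps : ∀ n → 10 ^ n ≤ 2 ^ reps n
10^n≤2^reps n = begin
  10 ^ n        ≤⟨ ^-monoˡ-≤ n (toWitness {a? = 10 ≤? 2 ^ 100} _) ⟩
  (2 ^ 100) ^ n ≡⟨ ^-*-assoc 2 100 n ⟩
  2 ^ reps n    ∎
  where open ≤-Reasoning

10^n*countB-allSatisfy≤length-draws : ∀ {n s} (f : DNF n s) (T : Term n)
  → (∀ U → U ∈T f → s * s < 2 ^ dterm T U)
  → 10 ^ n * countB (allSatisfy f) (draws T) ≤ length (draws T)
10^n*countB-allSatisfy≤length-draws {n} f T far = begin
  10 ^ n * countB (allSatisfy f) (draws T) ≡⟨ cong (10 ^ n *_) (countB-all-allSeqs (eval f) (reps n) (satAssign T)) ⟩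
  10 ^ n * c ^ reps n                      ≤⟨ *-monoˡ-≤ (c ^ reps n) (10^n≤2^reps n) ⟩
  2 ^ reps n * c ^ reps n                  ≡⟨ sym (^-distribʳ-* 2 c (reps n)) ⟩
  (2 * c) ^ reps n                         ≤⟨ ^-monoˡ-≤ (reps n) (2*countB-eval≤length-satAssign f T far) ⟩
  length (satAssign T) ^ reps n            ≡⟨ sym (length-allSeqs (reps n) (satAssign T)) ⟩
  length (draws T)                         ∎
  where
  open ≤-Reasoning
  c = countB (eval f) (satAssign T)

length-seeds : ∀ {n} (U : Term n) (L : List (Term n))
             → length (seeds (U ∷ L)) ≡ length (draws U) * length (seeds L)
length-seeds U L = length-concatMap-map _∷_ (draws U) (seeds L)

-- (E at p) ω: the draws of ω for the occurrence p satisfy E.  A seed shorter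
-- than L (never an element of  seeds L) satisfies every such event.
_at_ : ∀ {n} {T : Term n} {L : List (Term n)}
     → (Vec (Assign n) (reps n) → Bool) → T ∈ L → List (Vec (Assign n) (reps n)) → Bool
(E at p)         []      = true
(E at here _)    (d ∷ ω) = E d
(E at there p)   (d ∷ ω) = (E at p) ω

c*countB-at≤length-seeds : ∀ {n} {T : Term n} {L : List (Term n)} (E : Vec (Assign n) (reps n) → Bool) (c : ℕ)
  → c * countB E (draws T) ≤ length (draws T)
  → (p : T ∈ L) → c * countB (E at p) (seeds L) ≤ length (seeds L)
c*countB-at≤length-seeds {T = T} {T ∷ L} E c bound (here refl) = begin
  c * countB (E at here refl) (seeds (T ∷ L))
    ≡⟨ cong (c *_) (countB-concatMap-map _∷_ (λ d _ → sym (∧-identityʳ (E d))) (draws T) (seeds L)) ⟩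
  c * (countB E (draws T) * countB (λ _ → true) (seeds L))
    ≡⟨ sym (*-assoc c _ _) ⟩
  c * countB E (draws T) * countB (λ _ → true) (seeds L)
    ≤⟨ *-monoˡ-≤ _ bound ⟩
  length (draws T) * countB (λ _ → true) (seeds L)
    ≡⟨ cong (length (draws T) *_) (sym (length≡countB-true (seeds L))) ⟩
  length (draws T) * length (seeds L)
    ≡⟨ sym (length-seeds T L) ⟩
  length (seeds (T ∷ L)) ∎
  where open ≤-Reasoning
c*countB-at≤length-seeds {L = U ∷ L} E c bound (there p) = begin
  c * countB (E at there p) (seeds (U ∷ L))
    ≡⟨ cong (c *_) (countB-concatMap-map _∷_ (λ _ _ → refl) (draws U) (seeds L)) ⟩
  c * (countB (λ _ → true) (draws U) * countB (E at p) (seeds L))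
    ≡⟨ cong (λ m → c * (m * countB (E at p) (seeds L))) (sym (length≡countB-true (draws U))) ⟩
  c * (length (draws U) * countB (E at p) (seeds L))
    ≡⟨ *-comm-middle c (length (draws U)) _ ⟩
  length (draws U) * (c * countB (E at p) (seeds L))
    ≤⟨ *-monoʳ-≤ (length (draws U)) (c*countB-at≤length-seeds E c bound p) ⟩
  length (draws U) * length (seeds L)
    ≡⟨ sym (length-seeds U L) ⟩
  length (seeds (U ∷ L)) ∎
  where
  open ≤-Reasoning
  *-comm-middle : ∀ a b x → a * (b * x) ≡ b * (a * x)
  *-comm-middle = solve-∀

-- Definitionally equal to the list of removed terms local to  prune.
removedTerms : ∀ {n s} → ℕ → DNF n s → List (Term n) → List (Vec (Assign n) (reps n)) → List (Term n)
removedTerms k f L ω =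
  mapMaybe (λ q → if removed k f (proj₁ q) (proj₂ q) then just (proj₁ q) else nothing) (zip L ω)

memB-here : ∀ {n} (T : Term n) (R : List (Term n)) → memB T (T ∷ R) ≡ true
memB-here T R with T ≟T T
... | yes _   = refl
... | no T≢T = ⊥-elim (T≢T refl)

memB-filter-notMemB : ∀ {n} (T : Term n) (R L : List (Term n))
  → memB T (filter (λ U → Data.Bool._≟_ (memB U R) false) L) ≡ true → memB T R ≡ false
memB-filter-notMemB T R [] ()
memB-filter-notMemB T R (U ∷ L) T∈ with memB U R in U∉R
... | true  = memB-filter-notMemB T R L T∈
... | false with T ≟T U
...   | yes refl = U∉R
...   | no _     = memB-filter-notMemB T R L T∈

notRemoved⇒allSatisfy : ∀ {n s} k (f : DNF n s) (T : Term n) d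
  → removed k f T d ≡ false → allSatisfy f d ≡ true
notRemoved⇒allSatisfy k f T d notRemoved = x∨¬y≡false⇒y≡true _ _ notRemoved
  where
  x∨¬y≡false⇒y≡true : ∀ x y → x ∨ not y ≡ false → y ≡ true
  x∨¬y≡false⇒y≡true false true  _  = refl
  x∨¬y≡false⇒y≡true false false ()
  x∨¬y≡false⇒y≡true true  _     ()

notMemB-removedTerms⇒allSatisfy-at : ∀ {n s} k (f : DNF n s) {T : Term n} {L : List (Term n)}
  (p : T ∈ L) (ω : List (Vec (Assign n) (reps n)))
  → memB T (removedTerms k f L ω) ≡ false → (allSatisfy f at p) ω ≡ true
notMemB-removedTerms⇒allSatisfy-at k f p [] _ = refl
notMemB-removedTerms⇒allSatisfy-at k f {T} {T ∷ L} (here refl) (d ∷ ω) T∉R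
  with removed k f T d in notRemoved
... | false = notRemoved⇒allSatisfy k f T d notRemoved
... | true  with () ← trans (sym (memB-here T (removedTerms k f L ω))) T∉R
notMemB-removedTerms⇒allSatisfy-at k f {T} {U ∷ L} (there p) (d ∷ ω) T∉R
  with removed k f U d
... | false = notMemB-removedTerms⇒allSatisfy-at k f p ω T∉R
... | true  = notMemB-removedTerms⇒allSatisfy-at k f p ω (∨-false⇒ʳ T∉R)
  where
  ∨-false⇒ʳ : ∀ {x y} → x ∨ y ≡ false → y ≡ false
  ∨-false⇒ʳ {false} y≡false = y≡false

survives⇒allSatisfy-at : ∀ {n s} k (f : DNF n s) {T : Term n} {L : List (Term n)} (p : T ∈ L)
  (ω : List (Vec (Assign n) (reps n)))
  → memB T (prune k f L ω) ≡ true → (allSatisfy f at p) ω ≡ true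
survives⇒allSatisfy-at k f {T} {L} p ω survives =
  notMemB-removedTerms⇒allSatisfy-at k f p ω
    (memB-filter-notMemB T (removedTerms k f L ω) L survives)

lemma9p2 : (n s k : ℕ) (f : DNF n s) → ExactK k f
         → (L : List (Term n)) (T : Term n) → T ∈ L
         → (∀ (T′ : Term n) → T′ ∈T f → s * s < 2 ^ dterm T T′)
         → 10 ^ n * probNum k f L T ≤ probDen L
lemma9p2 n s k f _ L T T∈L far = begin
  10 ^ n * probNum k f L T
    ≤⟨ *-monoʳ-≤ (10 ^ n) (countB-mono (survives⇒allSatisfy-at k f T∈L) (seeds L)) ⟩
  10 ^ n * countB (allSatisfy f at T∈L) (seeds L)
    ≤⟨ c*countB-at≤length-seeds (allSatisfy f) (10 ^ n) (10^n*countB-allSatisfy≤length-draws f T far) T∈L ⟩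
  probDen L ∎
  where open ≤-Reasoning
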